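{- Let $G$ be a finite simple graph with at least one vertex and degeneracy $p$. For each $i\in\{\delta(G),\dots,p\}$ let $C_i$ be the set of cheap vertices $v$ of $G$ with $\zeta(v)=i$, and for each such $i$ with $C_i\neq\varnothing$ let $S_i$ be any nonempty independent set of $G[C_i]$. Define $\lambda_i=1-\frac{e_i}{|S_i|}+\frac{|N(S_i)|}{|S_i|}$, where $e_i$ is the number of edges of $G$ between $S_i$ and $N(S_i)$. Let $j$ be an index with $\lambda_j=\min_i\lambda_i$ (minimum over the indices $i$ for which $S_i$ is defined), and set $\lambda=\lambda_j$, $S=S_j$. Then $$\alpha(G)\geq \sum_{v\in N[S]}\frac{1}{\zeta(v)+\lambda}+\sum_{v\in V(G)\setminus N[S]}\frac{1}{\zeta(v)+1}.$$
   Context: $\alpha(G)$ is the independence number; $\delta(G)$ is the minimum degree. For a vertex $v$, $\zeta(v)=\max_H\delta(H)$, the maximum over all subgraphs $H$ of $G$ containing $v$. The degeneracy of $G$ is $\max_{H\subseteq G}\delta(H)$. For $X\subseteq V(G)$, $N(X)=\bigcup_{v\in X}N(v)$, $N[X]=N(X)\cup X$. A vertex $u$ is cheap if $\zeta(u)=\deg_G(u)$ and $\zeta(u)=\min_{v\in N[u]}\zeta(v)$. -}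

module Defs where

open import Data.Bool using (Bool; true; false; if_then_else_; _∧_; _∨_; T)
open import Data.Nat using (ℕ; zero; suc; _≤_)
open import Data.Fin using (Fin; zero; suc)
open import Data.Product using (Σ; ∃; ∃-syntax; _×_; _,_)
open import Data.Rational as ℚ using (ℚ; 0ℚ; 1ℚ; _+_; _-_; _*_; 1/_; ≢-nonZero)
open import Relation.Binary.PropositionalEquality using (_≡_)
open import Relation.Nullary using (yes; no)
open import Data.Sum using (_⊎_)
open import Data.Integer using (+_)

record Graph (n : ℕ) : Set where
  field
    adj    : Fin n → Fin n → Bool
    sym    : ∀ u v → adj u v ≡ adj v u
    irrefl : ∀ v → adj v v ≡ false
open Graph public

VSet : ℕ → Set
VSet n = Fin n → Bool

count : ∀ {n} → (Fin n → Bool) → ℕ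
count {zero}  f = 0
count {suc n} f = (if f zero then 1 else 0) Data.Nat.+ count (λ i → f (suc i))

anyV : ∀ {n} → (Fin n → Bool) → Bool
anyV {zero}  f = false
anyV {suc n} f = f zero ∨ anyV (λ i → f (suc i))

sumℕ : ∀ {n} → (Fin n → ℕ) → ℕ
sumℕ {zero}  f = 0
sumℕ {suc n} f = f zero Data.Nat.+ sumℕ (λ i → f (suc i))

sumQ : ∀ {n} → (Fin n → ℚ) → ℚ
sumQ {zero}  f = 0ℚ
sumQ {suc n} f = f zero + sumQ (λ i → f (suc i))

ℕtoℚ : ℕ → ℚ
ℕtoℚ k = (+ k) ℚ./ 1

-- total reciprocal: 1/q for q ≠ 0, and 0 for q = 0 (only ever applied to
-- positive numbers in the theorem).
recip : ℚ → ℚ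
recip q with q ℚ.≟ 0ℚ
... | yes _ = 0ℚ
... | no q≢0 = 1/_ q {{≢-nonZero q≢0}}

module _ {n : ℕ} (G : Graph n) where

  deg : Fin n → ℕ
  deg v = count (adj G v)

  MinDegreeG : ℕ → Set
  MinDegreeG d = (∀ v → d ≤ deg v) × (∃[ v ] deg v ≡ d)

  record Subgraph : Set where
    field
      U      : VSet n
      E      : Fin n → Fin n → Bool
      E-sym  : ∀ u w → E u w ≡ E w u
      E-adj  : ∀ u w → E u w ≡ true → adj G u w ≡ true
      E-U    : ∀ u w → E u w ≡ true → U u ≡ true
  open Subgraph public

  degH : Subgraph → Fin n → ℕ
  degH H u = count (E H u)

  MinDegreeH : Subgraph → ℕ → Set
  MinDegreeH H d = (∀ u → U H u ≡ true → d ≤ degH H u)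
                 × (∃[ u ] (U H u ≡ true × degH H u ≡ d))

  IsMax : (ℕ → Set) → ℕ → Set
  IsMax P k = P k × (∀ m → P m → m ≤ k)

  ZetaIs : Fin n → ℕ → Set
  ZetaIs v = IsMax (λ d → Σ Subgraph λ H → U H v ≡ true × MinDegreeH H d)

  DegeneracyIs : ℕ → Set
  DegeneracyIs = IsMax (λ d → Σ Subgraph λ H → MinDegreeH H d)

  Independent : VSet n → Set
  Independent S = ∀ u w → S u ≡ true → S w ≡ true → adj G u w ≡ false

  IndependenceNumberIs : ℕ → Set
  IndependenceNumberIs = IsMax (λ k → Σ (VSet n) λ I → Independent I × count I ≡ k)

  N : VSet n → VSet n
  N X w = anyV (λ u → X u ∧ adj G u w)

  Nc : VSet n → VSet n
  Nc X w = X w ∨ N X w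

  Cheap : (Fin n → ℕ) → Fin n → Set
  Cheap ζ u = ζ u ≡ deg u
            × (∀ v → (v ≡ u ⊎ adj G u v ≡ true) → ζ u ≤ ζ v)

  InC : (Fin n → ℕ) → ℕ → Fin n → Set
  InC ζ i v = Cheap ζ v × ζ v ≡ i

  eS : VSet n → ℕ
  eS S = sumℕ (λ u → if S u then count (λ w → N S w ∧ adj G u w) else 0)

  lam : VSet n → ℚ
  lam S = 1ℚ - ℕtoℚ (eS S) * recip (ℕtoℚ (count S))
             + ℕtoℚ (count (N S)) * recip (ℕtoℚ (count S))

-- A greedy argument in the spirit of Caro and Wei, which repeatedly deletes the closed
-- neighbourhood of a vertex u of minimum degree d in what is left, finds in any vertex set W an
-- independent set of size at least the sum over W of 1/(ζ(v)+1): since d ≤ ζ(v) for every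
-- remaining v, the d+1 deleted vertices carry weight at most 1.  Every vertex of S is cheap with
-- ζ = j, so its j edges all go to N(S); hence e(S, N(S)) = j|S| and λ = 1 − j + |N(S)|/|S|.
-- As ζ ≥ j on N[S] and |N[S]| = |S| + |N(S)|, the vertices of N[S] carry weight at most |S|.
-- So S together with a greedy independent set in V ∖ N[S] is an independent set of the
-- required size.

module Submission where

open import Defs hiding (sym)
open import Data.Bool using (Bool; true; false; if_then_else_; _∧_; _∨_; not)
open import Data.Bool.Properties using (∧-conicalˡ; ∧-conicalʳ; ∧-zeroʳ)
  renaming (_≟_ to _≟ᵇ_)
open import Data.Fin using (Fin; zero; suc)
open import Data.Fin.Properties using (any?) renaming (_≟_ to _≟ᶠ_)
import Data.Integer as ℤ
import Data.Integer.Properties as ℤP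
open import Data.List using (filter; allFin)
open import Data.List.Membership.Propositional.Properties using (∈-filter⁺; ∈-allFin)
import Data.List.Relation.Unary.All as All
open import Data.List.Relation.Unary.All.Properties using (all-filter)
open import Data.Nat as ℕ using (ℕ; zero; suc; _≤_; _<_; z≤n; s≤s)
open import Data.Nat.Induction using (<-wellFounded)
import Data.Nat.Properties as ℕP
open import Data.List.Extrema ℕP.≤-totalOrder using (argmin; argmin-all; f[argmin]≤f[xs])
open import Data.Product using (∃; ∃-syntax; _×_; _,_; proj₁; proj₂)
open import Data.Sum using (_⊎_; inj₁; inj₂)
open import Data.Rational as ℚ using (ℚ; 0ℚ; 1ℚ; _+_; _*_; _-_; toℚᵘ)
import Data.Rational.Properties as ℚP
open import Data.Rational.Solver using (module +-*-Solver)
import Data.Rational.Unnormalised as ℚᵘ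
import Data.Rational.Unnormalised.Properties as ℚᵘP
open import Induction.WellFounded using (Acc; acc)
open import Relation.Binary.PropositionalEquality
  using (_≡_; _≢_; refl; sym; trans; cong; cong₂; subst; module ≡-Reasoning)
open import Relation.Nullary using (yes; no; does; contradiction)

private
  variable
    n : ℕ

_∪_ : VSet n → VSet n → VSet n
(A ∪ B) v = A v ∨ B v

_∖_ : VSet n → VSet n → VSet n
(A ∖ B) v = A v ∧ not (B v)

∁ : VSet n → VSet n
∁ A v = not (A v)

⟦_⟧ : Fin n → VSet n
⟦ u ⟧ v = does (u ≟ᶠ v)

_⊆_ : VSet n → VSet n → Set
A ⊆ B = ∀ {v} → A v ≡ true → B v ≡ true

Disjoint : VSet n → VSet n → Set
Disjoint A B = ∀ {v} → A v ≡ true → B v ≡ false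

not-∨-true : ∀ x y → not (x ∨ y) ≡ true → x ≡ false × y ≡ false
not-∨-true false false _  = refl , refl
not-∨-true true  _     ()
not-∨-true false true  ()

∨-true : ∀ x {y} → x ∨ y ≡ true → x ≡ true ⊎ y ≡ true
∨-true true  _   = inj₁ refl
∨-true false y≡t = inj₂ y≡t

⟦⟧-sound : ∀ {u v : Fin n} → ⟦ u ⟧ v ≡ true → u ≡ v
⟦⟧-sound {u = u} {v} _ with u ≟ᶠ v
... | yes u≡v = u≡v

⟦⟧⊆ : (A : VSet n) {u : Fin n} → A u ≡ true → ⟦ u ⟧ ⊆ A
⟦⟧⊆ A Au uv = subst (λ w → A w ≡ true) (⟦⟧-sound uv) Au

∪-⊆ : {A B C : VSet n} → A ⊆ C → B ⊆ C → (A ∪ B) ⊆ C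
∪-⊆ {A = A} A⊆C B⊆C {v} ABv with ∨-true (A v) ABv
... | inj₁ Av = A⊆C Av
... | inj₂ Bv = B⊆C Bv

disjoint-sym : {A B : VSet n} → Disjoint A B → Disjoint B A
disjoint-sym {A = A} A#B {v} Bv with A v in Av
... | true  = contradiction (trans (sym Bv) (A#B Av)) λ ()
... | false = refl

∖-disjoint : {A B : VSet n} → Disjoint B (A ∖ B)
∖-disjoint {A = A} {v = v} Bv rewrite Bv = ∧-zeroʳ (A v)

∖-∉ : {A B : VSet n} → (A ∖ B) ⊆ ∁ B
∖-∉ {A = A} {B = B} {v} = ∧-conicalʳ (A v) (not (B v))

⊆-∪-∖ : {A B : VSet n} → B ⊆ A → ∀ v → A v ≡ (B ∪ (A ∖ B)) v
⊆-∪-∖ {A = A} {B} B⊆A v with B v in Bv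
... | true  = B⊆A Bv
... | false with A v
...   | true  = refl
...   | false = refl

count-cong : {A B : VSet n} → (∀ v → A v ≡ B v) → count A ≡ count B
count-cong {zero}  _   = refl
count-cong {suc n} A≗B = cong₂ ℕ._+_ (cong (λ b → if b then 1 else 0) (A≗B zero))
                                    (count-cong (λ i → A≗B (suc i)))

count-∅ : count {n} (λ _ → false) ≡ 0
count-∅ {zero}  = refl
count-∅ {suc n} = count-∅ {n}

count-⟦⟧ : (u : Fin n) → count ⟦ u ⟧ ≡ 1
count-⟦⟧ {suc n} zero    = cong suc (count-∅ {n})
count-⟦⟧ {suc n} (suc u) = count-⟦⟧ u

count-∪ : {A B : VSet n} → Disjoint A B → count (A ∪ B) ≡ count A ℕ.+ count B
count-∪ {zero}  _ = refl
count-∪ {suc n} {A} {B} A#B with A zero in a | B zero in b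
... | true  | true  = contradiction (trans (sym b) (A#B a)) λ ()
... | true  | false = cong suc (count-∪ λ {v} → A#B {suc v})
... | false | true  = trans (cong suc (count-∪ λ {v} → A#B {suc v})) (sym (ℕP.+-suc _ _))
... | false | false = count-∪ λ {v} → A#B {suc v}

count-∖ : {A B : VSet n} → B ⊆ A → count A ≡ count B ℕ.+ count (A ∖ B)
count-∖ {A = A} {B} B⊆A = trans (count-cong (⊆-∪-∖ {A = A} {B} B⊆A)) (count-∪ {A = B} {A ∖ B} (∖-disjoint {A = A} {B}))

anyV⁺ : (f : Fin n → Bool) {u : Fin n} → f u ≡ true → anyV f ≡ true
anyV⁺ f {zero}  fu rewrite fu = refl
anyV⁺ f {suc u} fu with f zero
... | true  = refl
... | false = anyV⁺ (λ i → f (suc i)) fu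

anyV⁻ : (f : Fin n → Bool) → anyV f ≡ true → ∃[ u ] f u ≡ true
anyV⁻ {suc n} f any with f zero in f₀
... | true  = zero , f₀
... | false with anyV⁻ (λ i → f (suc i)) any
...   | u , fu = suc u , fu

sumℕ-if-const : {A : VSet n} {f : Fin n → ℕ} {c : ℕ} → (∀ {v} → A v ≡ true → f v ≡ c)
              → sumℕ (λ v → if A v then f v else 0) ≡ count A ℕ.* c
sumℕ-if-const {zero}  _ = refl
sumℕ-if-const {suc n} {A} f≡c with A zero in A₀
... | true  = cong₂ ℕ._+_ (f≡c A₀) (sumℕ-if-const (λ {v} → f≡c {suc v}))
... | false = sumℕ-if-const (λ {v} → f≡c {suc v})

count-pos : {A : VSet n} {u : Fin n} → A u ≡ true → 1 ≤ count A
count-pos {A = A} {u} Au = begin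
  1                                  ≡⟨ count-⟦⟧ u ⟨
  count ⟦ u ⟧                        ≤⟨ ℕP.m≤m+n _ _ ⟩
  count ⟦ u ⟧ ℕ.+ count (A ∖ ⟦ u ⟧)  ≡⟨ count-∖ {A = A} (⟦⟧⊆ A Au) ⟨
  count A                            ∎
  where open ℕP.≤-Reasoning

ℕtoℚ≃mkℚᵘ : ∀ k → toℚᵘ (ℕtoℚ k) ℚᵘ.≃ ℚᵘ.mkℚᵘ (ℤ.+ k) 0
ℕtoℚ≃mkℚᵘ k = ℚP.toℚᵘ-fromℚᵘ (ℚᵘ.mkℚᵘ (ℤ.+ k) 0)

ℕtoℚ-+ : ∀ a b → ℕtoℚ (a ℕ.+ b) ≡ ℕtoℚ a + ℕtoℚ b
ℕtoℚ-+ a b = ℚP.toℚᵘ-injective (begin-equality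
  toℚᵘ (ℕtoℚ (a ℕ.+ b))                            ≃⟨ ℕtoℚ≃mkℚᵘ (a ℕ.+ b) ⟩
  ℚᵘ.mkℚᵘ (ℤ.+ (a ℕ.+ b)) 0                          ≃⟨ ℚᵘ.*≡* (cong (ℤ._* ℤ.+ 1) +[a+b]) ⟩
  ℚᵘ.mkℚᵘ (ℤ.+ a) 0 ℚᵘ.+ ℚᵘ.mkℚᵘ (ℤ.+ b) 0             ≃⟨ ℚᵘP.+-cong (ℕtoℚ≃mkℚᵘ a) (ℕtoℚ≃mkℚᵘ b) ⟨
  toℚᵘ (ℕtoℚ a) ℚᵘ.+ toℚᵘ (ℕtoℚ b)                 ≃⟨ ℚP.toℚᵘ-homo-+ (ℕtoℚ a) (ℕtoℚ b) ⟨
  toℚᵘ (ℕtoℚ a + ℕtoℚ b)                           ∎)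
  where
  open ℚᵘP.≤-Reasoning
  +[a+b] : ℤ.+ (a ℕ.+ b) ≡ ℤ.+ a ℤ.* ℤ.+ 1 ℤ.+ ℤ.+ b ℤ.* ℤ.+ 1
  +[a+b] = trans (ℤP.pos-+ a b) (sym (cong₂ ℤ._+_ (ℤP.*-identityʳ (ℤ.+ a)) (ℤP.*-identityʳ (ℤ.+ b))))

ℕtoℚ-* : ∀ a b → ℕtoℚ (a ℕ.* b) ≡ ℕtoℚ a * ℕtoℚ b
ℕtoℚ-* a b = ℚP.toℚᵘ-injective (begin-equality
  toℚᵘ (ℕtoℚ (a ℕ.* b))                            ≃⟨ ℕtoℚ≃mkℚᵘ (a ℕ.* b) ⟩
  ℚᵘ.mkℚᵘ (ℤ.+ (a ℕ.* b)) 0                          ≃⟨ ℚᵘ.*≡* (cong (ℤ._* ℤ.+ 1) (ℤP.pos-* a b)) ⟩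
  ℚᵘ.mkℚᵘ (ℤ.+ a) 0 ℚᵘ.* ℚᵘ.mkℚᵘ (ℤ.+ b) 0             ≃⟨ ℚᵘP.*-cong (ℕtoℚ≃mkℚᵘ a) (ℕtoℚ≃mkℚᵘ b) ⟨
  toℚᵘ (ℕtoℚ a) ℚᵘ.* toℚᵘ (ℕtoℚ b)                 ≃⟨ ℚP.toℚᵘ-homo-* (ℕtoℚ a) (ℕtoℚ b) ⟨
  toℚᵘ (ℕtoℚ a * ℕtoℚ b)                           ∎)
  where open ℚᵘP.≤-Reasoning

ℕtoℚ-suc : ∀ k → ℕtoℚ (suc k) ≡ ℕtoℚ k + 1ℚ
ℕtoℚ-suc k = trans (cong ℕtoℚ (ℕP.+-comm 1 k)) (ℕtoℚ-+ k 1)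

ℕtoℚ-nonNeg : ∀ k → 0ℚ ℚ.≤ ℕtoℚ k
ℕtoℚ-nonNeg k = ℚP.nonNegative⁻¹ (ℕtoℚ k) {{ℚP.normalize-nonNeg k 1}}

ℕtoℚ-pos : ∀ {k} → 1 ≤ k → 0ℚ ℚ.< ℕtoℚ k
ℕtoℚ-pos {suc k} _ = ℚP.positive⁻¹ (ℕtoℚ (suc k)) {{ℚP.normalize-pos (suc k) 1}}

ℕtoℚ-mono-≤ : ∀ {a b} → a ≤ b → ℕtoℚ a ℚ.≤ ℕtoℚ b
ℕtoℚ-mono-≤ {a} {b} a≤b = begin
  ℕtoℚ a                      ≡⟨ ℚP.+-identityʳ (ℕtoℚ a) ⟨
  ℕtoℚ a + 0ℚ                 ≤⟨ ℚP.+-monoʳ-≤ (ℕtoℚ a) (ℕtoℚ-nonNeg (b ℕ.∸ a)) ⟩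
  ℕtoℚ a + ℕtoℚ (b ℕ.∸ a)     ≡⟨ ℕtoℚ-+ a (b ℕ.∸ a) ⟨
  ℕtoℚ (a ℕ.+ (b ℕ.∸ a))      ≡⟨ cong ℕtoℚ (ℕP.m+[n∸m]≡n a≤b) ⟩
  ℕtoℚ b                      ∎
  where open ℚP.≤-Reasoning

recip-inverseʳ : ∀ {q} → 0ℚ ℚ.< q → q * recip q ≡ 1ℚ
recip-inverseʳ {q} q>0 with q ℚ.≟ 0ℚ
... | yes q≡0 = contradiction (sym q≡0) (ℚP.<⇒≢ q>0)
... | no  q≢0 = ℚP.*-inverseʳ q {{ℚ.≢-nonZero q≢0}}

recip-nonNeg : ∀ {q} → 0ℚ ℚ.< q → 0ℚ ℚ.≤ recip q
recip-nonNeg {q} q>0 with q ℚ.≟ 0ℚ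
... | yes _   = ℚP.≤-refl
... | no  q≢0 = ℚP.<⇒≤ (ℚP.positive⁻¹ _ {{ℚP.1/pos⇒pos q {{ℚ.positive q>0}}}})

*-recip-cancelʳ : ∀ x {q} → 0ℚ ℚ.< q → (x * q) * recip q ≡ x
*-recip-cancelʳ x {q} q>0 = begin
  (x * q) * recip q   ≡⟨ ℚP.*-assoc x q (recip q) ⟩
  x * (q * recip q)   ≡⟨ cong (x *_) (recip-inverseʳ q>0) ⟩
  x * 1ℚ              ≡⟨ ℚP.*-identityʳ x ⟩
  x                   ∎
  where open ≡-Reasoning

+-as-*-recip : ∀ x {q} → 0ℚ ℚ.< q → q + x ≡ q * (1ℚ + x * recip q)
+-as-*-recip x {q} q>0 = begin
  q + x                     ≡⟨ cong (q +_) (ℚP.*-identityʳ x) ⟨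
  q + x * 1ℚ                ≡⟨ cong (λ y → q + x * y) (recip-inverseʳ q>0) ⟨
  q + x * (q * recip q)     ≡⟨ solve 3 (λ q x r → q :+ x :* (q :* r) := q :* (con 1ℚ :+ x :* r)) refl q x (recip q) ⟩
  q * (1ℚ + x * recip q)    ∎
  where
  open ≡-Reasoning
  open +-*-Solver

recip-antimono-≤ : ∀ {p q} → 0ℚ ℚ.< p → p ℚ.≤ q → recip q ℚ.≤ recip p
recip-antimono-≤ {p} {q} p>0 p≤q = begin
  recip q                       ≡⟨ *-recip-cancelʳ (recip q) p>0 ⟨
  (recip q * p) * recip p       ≤⟨ ℚP.*-monoʳ-≤-nonNeg (recip p) {{ℚ.nonNegative (recip-nonNeg p>0)}}
                                     (ℚP.*-monoˡ-≤-nonNeg (recip q) {{ℚ.nonNegative (recip-nonNeg q>0)}} p≤q) ⟩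
  (recip q * q) * recip p       ≡⟨ cong (_* recip p) (trans (ℚP.*-comm (recip q) q) (recip-inverseʳ q>0)) ⟩
  1ℚ * recip p                  ≡⟨ ℚP.*-identityˡ (recip p) ⟩
  recip p                       ∎
  where
  open ℚP.≤-Reasoning
  q>0 = ℚP.<-≤-trans p>0 p≤q

sumOver : VSet n → (Fin n → ℚ) → ℚ
sumOver A f = sumQ (λ v → if A v then f v else 0ℚ)

sumQ-cong : {f g : Fin n → ℚ} → (∀ v → f v ≡ g v) → sumQ f ≡ sumQ g
sumQ-cong {zero}  _   = refl
sumQ-cong {suc n} f≗g = cong₂ _+_ (f≗g zero) (sumQ-cong (λ i → f≗g (suc i)))

sumQ-+ : (f g : Fin n → ℚ) → sumQ (λ v → f v + g v) ≡ sumQ f + sumQ g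
sumQ-+ {zero}  f g = sym (ℚP.+-identityˡ 0ℚ)
sumQ-+ {suc n} f g = begin
  (f zero + g zero) + sumQ (λ i → f (suc i) + g (suc i))  ≡⟨ cong ((f zero + g zero) +_) (sumQ-+ f′ g′) ⟩
  (f zero + g zero) + (sumQ f′ + sumQ g′)                 ≡⟨ +-interchange ⟩
  (f zero + sumQ f′) + (g zero + sumQ g′)                 ∎
  where
  open ≡-Reasoning
  f′ g′ : Fin n → ℚ
  f′ i = f (suc i)
  g′ i = g (suc i)
  +-interchange : (f zero + g zero) + (sumQ f′ + sumQ g′) ≡ (f zero + sumQ f′) + (g zero + sumQ g′)
  +-interchange = solve 4 (λ a b c d → (a :+ b) :+ (c :+ d) := (a :+ c) :+ (b :+ d)) refl
                    (f zero) (g zero) (sumQ f′) (sumQ g′)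
    where open +-*-Solver

sumQ-if : (b : VSet n) (f g : Fin n → ℚ)
        → sumQ (λ v → if b v then f v else g v) ≡ sumOver b f + sumOver (∁ b) g
sumQ-if {n} b f g = trans (sumQ-cong split) (sumQ-+ {n} _ _)
  where
  split : ∀ v → (if b v then f v else g v)
              ≡ (if b v then f v else 0ℚ) + (if not (b v) then g v else 0ℚ)
  split v with b v
  ... | true  = sym (ℚP.+-identityʳ (f v))
  ... | false = sym (ℚP.+-identityˡ (g v))

sumOver-∪ : {A B : VSet n} (f : Fin n → ℚ) → Disjoint A B
          → sumOver (A ∪ B) f ≡ sumOver A f + sumOver B f
sumOver-∪ {n} {A} {B} f A#B = trans (sumQ-cong split) (sumQ-+ {n} _ _)
  where
  split : ∀ v → (if A v ∨ B v then f v else 0ℚ)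
              ≡ (if A v then f v else 0ℚ) + (if B v then f v else 0ℚ)
  split v with A v in Av | B v in Bv
  ... | true  | true  = contradiction (trans (sym Bv) (A#B Av)) λ ()
  ... | true  | false = sym (ℚP.+-identityʳ (f v))
  ... | false | _     = sym (ℚP.+-identityˡ _)

sumOver-∖ : {A B : VSet n} (f : Fin n → ℚ) → B ⊆ A
          → sumOver A f ≡ sumOver B f + sumOver (A ∖ B) f
sumOver-∖ {A = A} {B} f B⊆A =
  trans (sumQ-cong (λ v → cong (λ b → if b then f v else 0ℚ) (⊆-∪-∖ {A = A} {B} B⊆A v)))
        (sumOver-∪ f (∖-disjoint {A = A} {B}))

sumOver-≤-count* : {A : VSet n} {f : Fin n → ℚ} {c : ℚ}
                 → (∀ {v} → A v ≡ true → f v ℚ.≤ c) → sumOver A f ℚ.≤ ℕtoℚ (count A) * c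
sumOver-≤-count* {zero}  {c = c} _ = ℚP.≤-reflexive (sym (ℚP.*-zeroˡ c))
sumOver-≤-count* {suc n} {A} {f} {c} f≤c with A zero in A₀
... | false = begin
  0ℚ + sumOver A′ f′          ≡⟨ ℚP.+-identityˡ _ ⟩
  sumOver A′ f′               ≤⟨ sumOver-≤-count* (λ {v} → f≤c {suc v}) ⟩
  ℕtoℚ (count A′) * c         ∎
  where
  open ℚP.≤-Reasoning
  A′ = λ i → A (suc i)
  f′ = λ i → f (suc i)
... | true = begin
  f zero + sumOver A′ f′               ≤⟨ ℚP.+-mono-≤ (f≤c A₀) (sumOver-≤-count* (λ {v} → f≤c {suc v})) ⟩
  c + ℕtoℚ (count A′) * c              ≡⟨ cong (_+ ℕtoℚ (count A′) * c) (ℚP.*-identityˡ c) ⟨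
  1ℚ * c + ℕtoℚ (count A′) * c         ≡⟨ ℚP.*-distribʳ-+ c 1ℚ (ℕtoℚ (count A′)) ⟨
  (1ℚ + ℕtoℚ (count A′)) * c           ≡⟨ cong (_* c) (ℕtoℚ-+ 1 (count A′)) ⟨
  ℕtoℚ (suc (count A′)) * c            ∎
  where
  open ℚP.≤-Reasoning
  A′ = λ i → A (suc i)
  f′ = λ i → f (suc i)

module _ {n : ℕ} (G : Graph n) where

  nbrIn : VSet n → Fin n → VSet n
  nbrIn W u v = W v ∧ adj G u v

  degIn : VSet n → Fin n → ℕ
  degIn W u = count (nbrIn W u)

  closedNbrIn : VSet n → Fin n → VSet n
  closedNbrIn W u = ⟦ u ⟧ ∪ nbrIn W u

  NonAdjacent : VSet n → VSet n → Set
  NonAdjacent A B = ∀ {a b} → A a ≡ true → B b ≡ true → adj G a b ≡ false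

  IsMinDegreeIn : VSet n → Fin n → Set
  IsMinDegreeIn W u = W u ≡ true × (∀ {v} → W v ≡ true → degIn W u ≤ degIn W v)

  induced : VSet n → Subgraph G
  induced W = record
    { U     = W
    ; E     = λ a b → W a ∧ nbrIn W a b
    ; E-sym = symmetric
    ; E-adj = λ a b e → ∧-conicalʳ (W b) _ (∧-conicalʳ (W a) _ e)
    ; E-U   = λ a b e → ∧-conicalˡ (W a) _ e
    }
    where
    symmetric : ∀ a b → W a ∧ (W b ∧ adj G a b) ≡ W b ∧ (W a ∧ adj G b a)
    symmetric a b rewrite Graph.sym G a b with W a | W b
    ... | true  | _     = refl
    ... | false | true  = refl
    ... | false | false = refl

  degH-induced : ∀ {W a} → W a ≡ true → degH G (induced W) a ≡ degIn W a
  degH-induced {W} {a} Wa = count-cong (λ b → cong (_∧ nbrIn W a b) Wa)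

  ζ-≥-minDegree : ∀ W u {v k} → ZetaIs G v k → W v ≡ true → IsMinDegreeIn W u → degIn W u ≤ k
  ζ-≥-minDegree W u (_ , maximal) Wv (Wu , minimal) =
    maximal (degIn W u) (induced W , Wv , lower , u , Wu , degH-induced Wu)
    where
    lower : ∀ a → W a ≡ true → degIn W u ≤ degH G (induced W) a
    lower a Wa = subst (degIn W u ≤_) (sym (degH-induced Wa)) (minimal Wa)

  minDegreeVertex : ∀ {W v₀} → W v₀ ≡ true → ∃[ u ] IsMinDegreeIn W u
  minDegreeVertex {W} {v₀} Wv₀ =
    u , argmin-all (degIn W) Wv₀ (all-filter W? (allFin n))
      , λ {v} Wv → All.lookup (f[argmin]≤f[xs] v₀ vs) (∈-filter⁺ W? (∈-allFin v) Wv)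
    where
    W? = λ v → W v ≟ᵇ true
    vs = filter W? (allFin n)
    u  = argmin (degIn W) v₀ vs

  independent-⟦⟧ : (u : Fin n) → Independent G ⟦ u ⟧
  independent-⟦⟧ u a b ua ub with ⟦⟧-sound {u = u} {a} ua | ⟦⟧-sound {u = u} {b} ub
  ... | refl | refl = irrefl G u

  independent-∪ : ∀ {A B} → Independent G A → Independent G B → NonAdjacent A B
                → Independent G (A ∪ B)
  independent-∪ {A} indA indB A≁B a b ABa ABb with ∨-true (A a) ABa | ∨-true (A b) ABb
  ... | inj₁ Aa | inj₁ Ab = indA a b Aa Ab
  ... | inj₁ Aa | inj₂ Bb = A≁B Aa Bb
  ... | inj₂ Ba | inj₁ Ab = trans (Graph.sym G a b) (A≁B Ab Ba)
  ... | inj₂ Ba | inj₂ Bb = indB a b Ba Bb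

  -- A Caro–Wei bound with ζ in place of the degree

  DominatesMinDegree : (Fin n → ℕ) → Set
  DominatesMinDegree f = ∀ W u {v} → IsMinDegreeIn W u → W v ≡ true → degIn W u ≤ f v

  CaroWeiSet : (Fin n → ℕ) → VSet n → Set
  CaroWeiSet f W = ∃[ I ] Independent G I × I ⊆ W
                        × sumOver W (λ v → recip (ℕtoℚ (f v) + 1ℚ)) ℚ.≤ ℕtoℚ (count I)

  ζ-dominates : ∀ {ζ} → (∀ v → ZetaIs G v (ζ v)) → DominatesMinDegree ζ
  ζ-dominates ζ-max W u {v} min Wv = ζ-≥-minDegree W u (ζ-max v) Wv min

  closedNbrIn⊆ : ∀ W {u} → W u ≡ true → closedNbrIn W u ⊆ W
  closedNbrIn⊆ W {u} Wu = ∪-⊆ {A = ⟦ u ⟧} {nbrIn W u} (⟦⟧⊆ W Wu) (λ {v} → ∧-conicalˡ (W v) _)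

  count-closedNbrIn : ∀ W u → count (closedNbrIn W u) ≡ suc (degIn W u)
  count-closedNbrIn W u =
    trans (count-∪ {A = ⟦ u ⟧} {nbrIn W u} u∉N) (cong (ℕ._+ degIn W u) (count-⟦⟧ u))
    where
    u∉N : Disjoint ⟦ u ⟧ (nbrIn W u)
    u∉N {v} uv with ⟦⟧-sound {u = u} {v} uv
    ... | refl rewrite irrefl G u = ∧-zeroʳ (W u)

  module _ (f : Fin n → ℕ) (dom : DominatesMinDegree f) where

    private
      w : Fin n → ℚ
      w v = recip (ℕtoℚ (f v) + 1ℚ)

    closedNbrIn-weight : ∀ W u → IsMinDegreeIn W u → sumOver (closedNbrIn W u) w ℚ.≤ 1ℚ
    closedNbrIn-weight W u min@(Wu , _) = begin
      sumOver C w                                ≤⟨ sumOver-≤-count* {A = C} weight≤ ⟩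
      ℕtoℚ (count C) * recip (ℕtoℚ (count C))    ≡⟨ recip-inverseʳ C>0 ⟩
      1ℚ                                         ∎
      where
      open ℚP.≤-Reasoning
      C = closedNbrIn W u
      C>0 : 0ℚ ℚ.< ℕtoℚ (count C)
      C>0 = ℕtoℚ-pos (subst (1 ≤_) (sym (count-closedNbrIn W u)) (s≤s z≤n))
      weight≤ : ∀ {v} → C v ≡ true → w v ℚ.≤ recip (ℕtoℚ (count C))
      weight≤ {v} Cv = recip-antimono-≤ C>0 (begin
        ℕtoℚ (count C)           ≡⟨ cong ℕtoℚ (count-closedNbrIn W u) ⟩
        ℕtoℚ (suc (degIn W u))   ≤⟨ ℕtoℚ-mono-≤ (s≤s (dom W u min (closedNbrIn⊆ W Wu Cv))) ⟩
        ℕtoℚ (suc (f v))         ≡⟨ ℕtoℚ-suc (f v) ⟩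
        ℕtoℚ (f v) + 1ℚ          ∎)

    caroWei-∅ : ∀ W → (∀ {v} → W v ≢ true) → CaroWeiSet f W
    caroWei-∅ W W≡∅ = (λ _ → false) , (λ _ _ ()) , (λ ()) , (begin
      sumOver W w                     ≤⟨ sumOver-≤-count* {A = W} {c = 0ℚ} (λ Wv → contradiction Wv W≡∅) ⟩
      ℕtoℚ (count W) * 0ℚ             ≡⟨ ℚP.*-zeroʳ (ℕtoℚ (count W)) ⟩
      0ℚ                              ≡⟨ cong ℕtoℚ (count-∅ {n}) ⟨
      ℕtoℚ (count {n} (λ _ → false))  ∎)
      where open ℚP.≤-Reasoning

    caroWei-step : ∀ W u → IsMinDegreeIn W u → CaroWeiSet f (W ∖ closedNbrIn W u) → CaroWeiSet f W
    caroWei-step W u min@(Wu , _) (I , indI , I⊆ , weightI) =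
      ⟦ u ⟧ ∪ I , independent-∪ (independent-⟦⟧ u) indI u≁I
                , ∪-⊆ {A = ⟦ u ⟧} {I} (⟦⟧⊆ W Wu) (λ {v} Iv → ∧-conicalˡ (W v) _ (I⊆ Iv)) , (begin
      sumOver W w                          ≡⟨ sumOver-∖ w (closedNbrIn⊆ W Wu) ⟩
      sumOver C w + sumOver (W ∖ C) w      ≤⟨ ℚP.+-mono-≤ (closedNbrIn-weight W u min) weightI ⟩
      1ℚ + ℕtoℚ (count I)                  ≡⟨ ℕtoℚ-+ 1 (count I) ⟨
      ℕtoℚ (1 ℕ.+ count I)                 ≡⟨ cong (λ k → ℕtoℚ (k ℕ.+ count I)) (count-⟦⟧ u) ⟨
      ℕtoℚ (count ⟦ u ⟧ ℕ.+ count I)       ≡⟨ cong ℕtoℚ (count-∪ {A = ⟦ u ⟧} {I} u∉I) ⟨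
      ℕtoℚ (count (⟦ u ⟧ ∪ I))             ∎)
      where
      open ℚP.≤-Reasoning
      C = closedNbrIn W u
      outside : ∀ {b} → I b ≡ true → ⟦ u ⟧ b ≡ false × nbrIn W u b ≡ false
      outside Ib = not-∨-true _ _ (∖-∉ {A = W} {C} (I⊆ Ib))
      u∉I : Disjoint ⟦ u ⟧ I
      u∉I = disjoint-sym {A = I} (λ Ib → proj₁ (outside Ib))
      u≁I : NonAdjacent ⟦ u ⟧ I
      u≁I {a} {b} ua Ib with ⟦⟧-sound {u = u} {a} ua
      ... | refl = subst (λ x → x ∧ adj G u b ≡ false) (∧-conicalˡ (W b) _ (I⊆ Ib)) (proj₂ (outside Ib))

    caroWei : ∀ W → CaroWeiSet f W
    caroWei W = go W (<-wellFounded (count W))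
      where
      go : ∀ W → Acc _<_ (count W) → CaroWeiSet f W
      go W (acc rec) with any? (λ v → W v ≟ᵇ true)
      ... | no  W≡∅      = caroWei-∅ W (λ Wv → W≡∅ (_ , Wv))
      ... | yes (_ , Wv₀) with minDegreeVertex Wv₀
      ...   | u , min@(Wu , _) = caroWei-step W u min (go (W ∖ C) (rec shrinks))
        where
        C = closedNbrIn W u
        shrinks : count (W ∖ C) < count W
        shrinks = subst (count (W ∖ C) <_)
          (sym (trans (count-∖ {A = W} {C} (closedNbrIn⊆ W Wu))
                      (cong (ℕ._+ count (W ∖ C)) (count-closedNbrIn W u))))
          (s≤s (ℕP.m≤n+m _ _))

  -- Cheap independent sets

  neighbour-∈-N : ∀ S {a b} → S a ≡ true → adj G a b ≡ true → N G S b ≡ true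
  neighbour-∈-N S {a} {b} Sa ab = anyV⁺ (λ x → S x ∧ adj G x b) (trans (cong (_∧ adj G a b) Sa) ab)

  N-witness : ∀ S {b} → N G S b ≡ true → ∃[ a ] S a ≡ true × adj G a b ≡ true
  N-witness S {b} Nb with anyV⁻ (λ a → S a ∧ adj G a b) Nb
  ... | a , e = a , ∧-conicalˡ (S a) _ e , ∧-conicalʳ (S a) _ e

  independent⇒disjoint-N : ∀ {S} → Independent G S → Disjoint S (N G S)
  independent⇒disjoint-N {S} indS {v} Sv with N G S v in Nv
  ... | false = refl
  ... | true with N-witness S Nv
  ...   | a , Sa , av = contradiction (trans (sym av) (indS a v Sa Sv)) λ ()

  independent-∪-outside : ∀ {S I} → Independent G S → Independent G I → I ⊆ ∁ (Nc G S)
                        → Independent G (S ∪ I) × count (S ∪ I) ≡ count S ℕ.+ count I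
  independent-∪-outside {S} {I} indS indI I⊆ =
    independent-∪ indS indI S≁I , count-∪ {A = S} {I} (disjoint-sym {A = I} (λ Ib → proj₁ (outside Ib)))
    where
    outside : ∀ {b} → I b ≡ true → S b ≡ false × N G S b ≡ false
    outside Ib = not-∨-true _ _ (I⊆ Ib)
    S≁I : NonAdjacent S I
    S≁I {a} {b} Sa Ib with adj G a b in ab
    ... | false = refl
    ... | true  = contradiction (trans (sym (neighbour-∈-N S Sa ab)) (proj₂ (outside Ib))) λ ()

  module _ (ζ : Fin n → ℕ) {j : ℕ} (S : VSet n) (S⊆Cⱼ : ∀ {v} → S v ≡ true → InC G ζ j v) where

    Nc⇒j≤ζ : ∀ {v} → Nc G S v ≡ true → j ≤ ζ v
    Nc⇒j≤ζ {v} N[S]v with ∨-true (S v) N[S]v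
    ... | inj₁ Sv = ℕP.≤-reflexive (sym (proj₂ (S⊆Cⱼ Sv)))
    ... | inj₂ Nv with N-witness S Nv
    ...   | a , Sa , av = subst (_≤ ζ v) (proj₂ (S⊆Cⱼ Sa)) (proj₂ (proj₁ (S⊆Cⱼ Sa)) v (inj₂ av))

    eS-cheap : eS G S ≡ count S ℕ.* j
    eS-cheap = sumℕ-if-const {A = S} edges
      where
      edges : ∀ {u} → S u ≡ true → count (λ w → N G S w ∧ adj G u w) ≡ j
      edges {u} Su = begin
        count (λ w → N G S w ∧ adj G u w)   ≡⟨ count-cong into-N ⟩
        deg G u                             ≡⟨ proj₁ (proj₁ (S⊆Cⱼ Su)) ⟨
        ζ u                                 ≡⟨ proj₂ (S⊆Cⱼ Su) ⟩
        j                                   ∎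
        where
        open ≡-Reasoning
        into-N : ∀ w → (N G S w ∧ adj G u w) ≡ adj G u w
        into-N w with adj G u w in uw
        ... | true  rewrite neighbour-∈-N S Su uw = refl
        ... | false = ∧-zeroʳ (N G S w)

    module _ (S≠∅ : 1 ≤ count S) where

      private
        s m M : ℚ
        s = ℕtoℚ (count S)
        m = ℕtoℚ (count (N G S))
        M = m * recip s

        s>0 : 0ℚ ℚ.< s
        s>0 = ℕtoℚ-pos S≠∅

      lam-cheap : lam G S ≡ 1ℚ - ℕtoℚ j + M
      lam-cheap = cong (λ x → 1ℚ - x + M) (begin
        ℕtoℚ (eS G S) * recip s              ≡⟨ cong (λ k → ℕtoℚ k * recip s) (trans eS-cheap (ℕP.*-comm (count S) j)) ⟩
        ℕtoℚ (j ℕ.* count S) * recip s       ≡⟨ cong (_* recip s) (ℕtoℚ-* j (count S)) ⟩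
        (ℕtoℚ j * s) * recip s               ≡⟨ *-recip-cancelʳ (ℕtoℚ j) s>0 ⟩
        ℕtoℚ j                               ∎)
        where open ≡-Reasoning

      Nc-weight : Independent G S
                        → sumOver (Nc G S) (λ v → recip (ℕtoℚ (ζ v) + lam G S)) ℚ.≤ s
      Nc-weight indS = begin
        sumOver (Nc G S) (λ v → recip (ℕtoℚ (ζ v) + lam G S))
                                                ≤⟨ sumOver-≤-count* {A = Nc G S} weight≤ ⟩
        ℕtoℚ (count (Nc G S)) * recip t         ≡⟨ cong (λ k → ℕtoℚ k * recip t) (count-∪ {A = S} {N G S} (independent⇒disjoint-N indS)) ⟩
        ℕtoℚ (count S ℕ.+ count (N G S)) * recip t
                                                ≡⟨ cong (_* recip t) (trans (ℕtoℚ-+ (count S) (count (N G S))) (+-as-*-recip m s>0)) ⟩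
        (s * t) * recip t                       ≡⟨ *-recip-cancelʳ s t>0 ⟩
        s                                       ∎
        where
        open ℚP.≤-Reasoning
        t : ℚ
        t = 1ℚ + M
        M≥0 : 0ℚ ℚ.≤ M
        M≥0 = ℚP.nonNegative⁻¹ M {{ℚP.nonNeg*nonNeg⇒nonNeg m {{ℚ.nonNegative (ℕtoℚ-nonNeg (count (N G S)))}}
                                                   (recip s) {{ℚ.nonNegative (recip-nonNeg s>0)}}}}
        t>0 : 0ℚ ℚ.< t
        t>0 = ℚP.+-mono-<-≤ (ℕtoℚ-pos {1} ℕP.≤-refl) M≥0
        weight≤ : ∀ {v} → Nc G S v ≡ true → recip (ℕtoℚ (ζ v) + lam G S) ℚ.≤ recip t
        weight≤ {v} N[S]v = recip-antimono-≤ t>0 (begin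
          1ℚ + M                           ≡⟨ solve 2 (λ J M → con 1ℚ :+ M := J :+ (con 1ℚ :- J :+ M)) refl (ℕtoℚ j) M ⟩
          ℕtoℚ j + (1ℚ - ℕtoℚ j + M)       ≤⟨ ℚP.+-monoˡ-≤ (1ℚ - ℕtoℚ j + M) (ℕtoℚ-mono-≤ (Nc⇒j≤ζ N[S]v)) ⟩
          ℕtoℚ (ζ v) + (1ℚ - ℕtoℚ j + M)   ≡⟨ cong (ℕtoℚ (ζ v) +_) lam-cheap ⟨
          ℕtoℚ (ζ v) + lam G S             ∎)
          where open +-*-Solver

  cheap-independence-bound : ∀ ζ → (∀ v → ZetaIs G v (ζ v)) → ∀ {j} S → (∃[ v ] S v ≡ true)
    → (∀ {v} → S v ≡ true → InC G ζ j v) → Independent G S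
    → ∃[ J ] Independent G J
             × sumQ (λ v → if Nc G S v then recip (ℕtoℚ (ζ v) + lam G S) else recip (ℕtoℚ (ζ v) + 1ℚ))
                 ℚ.≤ ℕtoℚ (count J)
  cheap-independence-bound ζ ζ-max S (_ , Sv₀) S⊆Cⱼ indS = S ∪ I , proj₁ S∪I , (begin
    sumQ (λ v → if Nc G S v then recip (ℕtoℚ (ζ v) + lam G S) else recip (ℕtoℚ (ζ v) + 1ℚ))
      ≡⟨ sumQ-if (Nc G S) (λ v → recip (ℕtoℚ (ζ v) + lam G S)) (λ v → recip (ℕtoℚ (ζ v) + 1ℚ)) ⟩
    sumOver (Nc G S) (λ v → recip (ℕtoℚ (ζ v) + lam G S))
      + sumOver (∁ (Nc G S)) (λ v → recip (ℕtoℚ (ζ v) + 1ℚ))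
      ≤⟨ ℚP.+-mono-≤ (Nc-weight ζ S S⊆Cⱼ (count-pos {A = S} Sv₀) indS) weight≤I ⟩
    ℕtoℚ (count S) + ℕtoℚ (count I)   ≡⟨ ℕtoℚ-+ (count S) (count I) ⟨
    ℕtoℚ (count S ℕ.+ count I)        ≡⟨ cong ℕtoℚ (proj₂ S∪I) ⟨
    ℕtoℚ (count (S ∪ I))              ∎)
    where
    open ℚP.≤-Reasoning
    outside : CaroWeiSet ζ (∁ (Nc G S))
    outside = caroWei ζ (ζ-dominates ζ-max) (∁ (Nc G S))
    I = proj₁ outside
    weight≤I = proj₂ (proj₂ (proj₂ outside))
    S∪I = independent-∪-outside indS (proj₁ (proj₂ outside)) (proj₁ (proj₂ (proj₂ outside)))

theorem3 : (n : ℕ) → 1 ≤ n → (G : Graph n)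
    → (δ p α : ℕ) → MinDegreeG G δ → DegeneracyIs G p → IndependenceNumberIs G α
    → (ζ : Fin n → ℕ) → (∀ v → ZetaIs G v (ζ v))
    → (S : ℕ → VSet n)
    → (∀ i → δ ≤ i → i ≤ p → (∃[ v ] InC G ζ i v)
         → (∃[ v ] S i v ≡ true)
         × (∀ v → S i v ≡ true → InC G ζ i v)
         × Independent G (S i))
    → (j : ℕ) → δ ≤ j → j ≤ p → (∃[ v ] InC G ζ j v)
    → (∀ i → δ ≤ i → i ≤ p → (∃[ v ] InC G ζ i v) → lam G (S j) ℚ.≤ lam G (S i))
    → sumQ (λ v → if Nc G (S j) v
                    then recip (ℕtoℚ (ζ v) + lam G (S j))
                    else recip (ℕtoℚ (ζ v) + 1ℚ))
        ℚ.≤ ℕtoℚ α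
theorem3 n _ G δ p α _ _ α-max ζ ζ-max S S-spec j δ≤j j≤p Cⱼ≠∅ _ =
  let Sⱼ≠∅ , Sⱼ⊆Cⱼ , indSⱼ = S-spec j δ≤j j≤p Cⱼ≠∅
      J , indJ , weight≤J  = cheap-independence-bound G ζ ζ-max (S j) Sⱼ≠∅ (λ {v} → Sⱼ⊆Cⱼ v) indSⱼ
  in  ℚP.≤-trans weight≤J (ℕtoℚ-mono-≤ (proj₂ α-max (count J) (J , indJ , refl)))
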